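{- Let $n\ge 3$ and let $\overrightarrow{C}_n$ be the directed cycle on $n$ vertices. Then $\overrightarrow{rvc}(\overrightarrow{C}_n)=\overrightarrow{srvc}(\overrightarrow{C}_n)=n-2$ if $n\in\{3,4\}$, and $\overrightarrow{rvc}(\overrightarrow{C}_n)=\overrightarrow{srvc}(\overrightarrow{C}_n)=n$ if $n\ge 5$.
   Context: All digraphs are finite and simple. A (directed) path is a sequence of distinct vertices $x_0,\dots,x_\ell$ with each $x_{i-1}x_i$ an arc; its length is $\ell$. A digraph is strongly connected if for every ordered pair $(u,v)$ there is a $u$–$v$ path; a $u$–$v$ geodesic is a shortest $u$–$v$ path. In a vertex-coloured digraph, a path is rainbow if its internal vertices have pairwise distinct colours. A vertex-colouring of a strongly connected digraph $D$ is rainbow vertex-connected if every ordered pair $(u,v)$ is joined by a rainbow $u$–$v$ path, and strongly rainbow vertex-connected if every ordered pair is joined by a rainbow $u$–$v$ geodesic. $\overrightarrow{rvc}(D)$ (resp. $\overrightarrow{srvc}(D)$) is the minimum number of colours in a rainbow vertex-connected (resp. strongly rainbow vertex-connected) vertex-colouring of $D$. The directed cycle $\overrightarrow{C}_n$ has vertices $v_0,\dots,v_{n-1}$ and arcs $v_0v_1,v_1v_2,\dots,v_{n-2}v_{n-1},v_{n-1}v_0$. -}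

module Defs where

open import Data.Nat using (ℕ; zero; suc; _∸_; _≤_; _<_)
open import Data.Fin using (Fin; toℕ)
open import Data.List using (List; []; _∷_; map; length)
open import Data.List.Relation.Unary.Unique.Propositional using (Unique)
open import Data.Product using (Σ; _×_; ∃-syntax)
open import Data.Sum using (_⊎_)
open import Relation.Binary.PropositionalEquality using (_≡_)
open import Relation.Nullary using (¬_)

Digraph : ℕ → Set₁
Digraph n = Fin n → Fin n → Set

Cycle : (n : ℕ) → Digraph n
Cycle n i j = (suc (toℕ i) ≡ toℕ j) ⊎ ((suc (toℕ i) ≡ n) × (toℕ j ≡ 0))

module _ {n : ℕ} (D : Digraph n) where

  data Walk : Fin n → Fin n → List (Fin n) → Set where
    here : ∀ x → Walk x x (x ∷ [])
    step : ∀ {x y z xs} → D x y → Walk y z xs → Walk x z (x ∷ xs)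

  IsPath : Fin n → Fin n → List (Fin n) → Set
  IsPath u v xs = Walk u v xs × Unique xs

  IsGeodesic : Fin n → Fin n → List (Fin n) → Set
  IsGeodesic u v xs = IsPath u v xs × (∀ ys → IsPath u v ys → length xs ≤ length ys)

pathLength : ∀ {A : Set} → List A → ℕ
pathLength xs = length xs ∸ 1

dropLast : ∀ {A : Set} → List A → List A
dropLast [] = []
dropLast (x ∷ []) = []
dropLast (x ∷ y ∷ ys) = x ∷ dropLast (y ∷ ys)

internal : ∀ {A : Set} → List A → List A
internal [] = []
internal (x ∷ xs) = dropLast xs

Rainbow : ∀ {n k} → (Fin n → Fin k) → List (Fin n) → Set
Rainbow c xs = Unique (map c (internal xs))

module _ {n : ℕ} (D : Digraph n) where

  RVConnected : ∀ {k} → (Fin n → Fin k) → Set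
  RVConnected c = ∀ u v → ∃[ xs ] (IsPath D u v xs × Rainbow c xs)

  SRVConnected : ∀ {k} → (Fin n → Fin k) → Set
  SRVConnected c = ∀ u v → ∃[ xs ] (IsGeodesic D u v xs × Rainbow c xs)

  rvc≡ : ℕ → Set
  rvc≡ k = (Σ (Fin n → Fin k) RVConnected)
         × (∀ j → j < k → ¬ Σ (Fin n → Fin j) RVConnected)

  srvc≡ : ℕ → Set
  srvc≡ k = (Σ (Fin n → Fin k) SRVConnected)
          × (∀ j → j < k → ¬ Σ (Fin n → Fin j) SRVConnected)

-- In a directed cycle the only u–v path runs forward from u to v, so every path is a
-- geodesic and rvc = srvc. The internal vertices of these paths are exactly the runs of
-- at most n − 2 cyclically consecutive vertices, so a colouring is (strongly) rainbow
-- vertex-connected iff every such run is coloured injectively. For n = 3 one colour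
-- suffices and for n = 4 two alternating colours do; for n ≥ 5 any two vertices lie in
-- a common run, so the colouring must be injective, and the identity colouring works.

module Submission where

open import Defs
open import Data.Nat using (ℕ; zero; suc; _+_; _∸_; _≤_; _<_; z≤n; s≤s; NonZero)
open import Data.Nat.DivMod using (_%_; _mod_; %-distribˡ-+; m%n%n≡m%n; m%n<n; m<n⇒m%n≡m; n%n≡0; [m+n]%n≡m%n)
open import Data.Nat.Properties
open import Data.Fin using (Fin; toℕ; zero; suc)
open import Data.Fin.Properties using (toℕ-fromℕ<; toℕ-injective; toℕ<n; <⇒notInjective)
open import Data.List using (List; []; _∷_; map; length)
open import Data.List.Properties using (map-id)
open import Data.List.Membership.Propositional using (_∈_)
open import Data.List.Relation.Unary.All as All using ([]; _∷_)
open import Data.List.Relation.Unary.All.Properties using (map⁻)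
open import Data.List.Relation.Unary.Any using (here; there)
open import Data.List.Relation.Unary.AllPairs using ([]; _∷_)
open import Data.List.Relation.Unary.Unique.Propositional using (Unique)
open import Data.Product using (Σ; _×_; _,_; ∃-syntax)
open import Data.Sum using (inj₁; inj₂)
open import Data.Empty using (⊥-elim)
open import Function using (id; _∘_)
open import Function.Definitions using (Injective)
open import Relation.Binary.PropositionalEquality
open import Relation.Nullary using (¬_; yes; no)

open ≡-Reasoning

[m%d+n]%d≡[m+n]%d : ∀ m n d .{{_ : NonZero d}} → (m % d + n) % d ≡ (m + n) % d
[m%d+n]%d≡[m+n]%d m n d = begin
  (m % d + n) % d          ≡⟨ %-distribˡ-+ (m % d) n d ⟩
  (m % d % d + n % d) % d  ≡⟨ cong (λ t → (t + n % d) % d) (m%n%n≡m%n m d) ⟩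
  (m % d + n % d) % d      ≡⟨ %-distribˡ-+ m n d ⟨
  (m + n) % d              ∎

[m+n%d]%d≡[m+n]%d : ∀ m n d .{{_ : NonZero d}} → (m + n % d) % d ≡ (m + n) % d
[m+n%d]%d≡[m+n]%d m n d = begin
  (m + n % d) % d  ≡⟨ cong (_% d) (+-comm m (n % d)) ⟩
  (n % d + m) % d  ≡⟨ [m%d+n]%d≡[m+n]%d n m d ⟩
  (n + m) % d      ≡⟨ cong (_% d) (+-comm n m) ⟩
  (m + n) % d      ∎

SRVConnected⇒RVConnected : ∀ {n k} {D : Digraph n} {c : Fin n → Fin k} → SRVConnected D c → RVConnected D c
SRVConnected⇒RVConnected srvc u v with xs , (path , _) , rainbow ← srvc u v = xs , path , rainbow

rvc≡×srvc≡ : ∀ {n k} (D : Digraph n) → Σ (Fin n → Fin k) (SRVConnected D) →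
             (∀ j → j < k → ¬ Σ (Fin n → Fin j) (RVConnected D)) → rvc≡ D k × srvc≡ D k
rvc≡×srvc≡ D (c , srvc) noRVC =
  ((c , SRVConnected⇒RVConnected srvc) , noRVC) ,
  ((c , srvc) , λ j j<k (c′ , srvc′) → noRVC j j<k (c′ , SRVConnected⇒RVConnected srvc′))

module _ {m : ℕ} where

  rotate : ℕ → Fin (suc m) → Fin (suc m)
  rotate k x = (k + toℕ x) mod suc m

  toℕ-rotate : ∀ k x → toℕ (rotate k x) ≡ (k + toℕ x) % suc m
  toℕ-rotate k x = toℕ-fromℕ< _

  rotate-zero : ∀ x → rotate 0 x ≡ x
  rotate-zero x = toℕ-injective (trans (toℕ-rotate 0 x) (m<n⇒m%n≡m (toℕ<n x)))

  rotate-+ : ∀ i j x → rotate i (rotate j x) ≡ rotate (j + i) x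
  rotate-+ i j x = toℕ-injective (begin
    toℕ (rotate i (rotate j x))       ≡⟨ toℕ-rotate i _ ⟩
    (i + toℕ (rotate j x)) % suc m    ≡⟨ cong (λ t → (i + t) % suc m) (toℕ-rotate j x) ⟩
    (i + (j + toℕ x) % suc m) % suc m ≡⟨ [m+n%d]%d≡[m+n]%d i _ (suc m) ⟩
    (i + (j + toℕ x)) % suc m         ≡⟨ cong (_% suc m) (+-assoc i j _) ⟨
    (i + j + toℕ x) % suc m           ≡⟨ cong (λ t → (t + toℕ x) % suc m) (+-comm i j) ⟩
    (j + i + toℕ x) % suc m           ≡⟨ toℕ-rotate (j + i) x ⟨
    toℕ (rotate (j + i) x)            ∎)

  rotate-suc-m : ∀ x → rotate (suc m) x ≡ x
  rotate-suc-m x = toℕ-injective (begin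
    toℕ (rotate (suc m) x)     ≡⟨ toℕ-rotate (suc m) x ⟩
    (suc m + toℕ x) % suc m    ≡⟨ cong (_% suc m) (+-comm (suc m) (toℕ x)) ⟩
    (toℕ x + suc m) % suc m    ≡⟨ [m+n]%n≡m%n (toℕ x) (suc m) ⟩
    toℕ x % suc m              ≡⟨ m<n⇒m%n≡m (toℕ<n x) ⟩
    toℕ x                      ∎)

  rotate-% : ∀ k x → rotate (k % suc m) x ≡ rotate k x
  rotate-% k x = toℕ-injective (begin
    toℕ (rotate (k % suc m) x)   ≡⟨ toℕ-rotate (k % suc m) x ⟩
    (k % suc m + toℕ x) % suc m  ≡⟨ [m%d+n]%d≡[m+n]%d k (toℕ x) (suc m) ⟩
    (k + toℕ x) % suc m          ≡⟨ toℕ-rotate k x ⟨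
    toℕ (rotate k x)             ∎)

  toℕ-rotate-back : ∀ w x → toℕ (rotate (w + (suc m ∸ toℕ x)) x) ≡ w % suc m
  toℕ-rotate-back w x = begin
    toℕ (rotate (w + (suc m ∸ toℕ x)) x)  ≡⟨ toℕ-rotate (w + (suc m ∸ toℕ x)) x ⟩
    (w + (suc m ∸ toℕ x) + toℕ x) % suc m ≡⟨ cong (_% suc m) (+-assoc w _ (toℕ x)) ⟩
    (w + (suc m ∸ toℕ x + toℕ x)) % suc m ≡⟨ cong (λ t → (w + t) % suc m) (m∸n+n≡m (<⇒≤ (toℕ<n x))) ⟩
    (w + suc m) % suc m                   ≡⟨ [m+n]%n≡m%n w (suc m) ⟩
    w % suc m                             ∎

  rotate-surjective : ∀ u v → ∃[ k ] k < suc m × rotate k u ≡ v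
  rotate-surjective u v = k % suc m , m%n<n k (suc m) , toℕ-injective (begin
    toℕ (rotate (k % suc m) u)  ≡⟨ cong toℕ (rotate-% k u) ⟩
    toℕ (rotate k u)            ≡⟨ toℕ-rotate-back (toℕ v) u ⟩
    toℕ v % suc m               ≡⟨ m<n⇒m%n≡m (toℕ<n v) ⟩
    toℕ v                       ∎)
    where k = toℕ v + (suc m ∸ toℕ u)

  rotate-injective : ∀ {i j x} → i < suc m → j < suc m → rotate i x ≡ rotate j x → i ≡ j
  rotate-injective {i} {j} {x} i<n j<n eq = begin
    i                                      ≡⟨ m<n⇒m%n≡m i<n ⟨
    i % suc m                              ≡⟨ toℕ-rotate-back i x ⟨
    toℕ (rotate (i + (suc m ∸ toℕ x)) x)   ≡⟨ cong toℕ (rotate-+ _ i x) ⟨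
    toℕ (rotate (suc m ∸ toℕ x) (rotate i x)) ≡⟨ cong (toℕ ∘ rotate (suc m ∸ toℕ x)) eq ⟩
    toℕ (rotate (suc m ∸ toℕ x) (rotate j x)) ≡⟨ cong toℕ (rotate-+ _ j x) ⟩
    toℕ (rotate (j + (suc m ∸ toℕ x)) x)   ≡⟨ toℕ-rotate-back j x ⟩
    j % suc m                              ≡⟨ m<n⇒m%n≡m j<n ⟩
    j                                      ∎

  arc⇒rotate-1 : ∀ {x y} → Cycle (suc m) x y → y ≡ rotate 1 x
  arc⇒rotate-1 {x} {y} (inj₁ 1+x≡y) = toℕ-injective (begin
    toℕ y                ≡⟨ m<n⇒m%n≡m (toℕ<n y) ⟨
    toℕ y % suc m        ≡⟨ cong (_% suc m) 1+x≡y ⟨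
    suc (toℕ x) % suc m  ≡⟨ toℕ-rotate 1 x ⟨
    toℕ (rotate 1 x)     ∎)
  arc⇒rotate-1 {x} {y} (inj₂ (1+x≡n , y≡0)) = toℕ-injective (begin
    toℕ y                ≡⟨ y≡0 ⟩
    0                    ≡⟨ n%n≡0 (suc m) ⟨
    suc m % suc m        ≡⟨ cong (_% suc m) 1+x≡n ⟨
    suc (toℕ x) % suc m  ≡⟨ toℕ-rotate 1 x ⟨
    toℕ (rotate 1 x)     ∎)

  rotate-1-arc : ∀ x → Cycle (suc m) x (rotate 1 x)
  rotate-1-arc x with m≤n⇒m<n∨m≡n (toℕ<n x)
  ... | inj₁ 1+x<n = inj₁ (sym (trans (toℕ-rotate 1 x) (m<n⇒m%n≡m 1+x<n)))
  ... | inj₂ 1+x≡n = inj₂ (1+x≡n , trans (toℕ-rotate 1 x) (trans (cong (_% suc m) 1+x≡n) (n%n≡0 (suc m))))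

  orbit : Fin (suc m) → ℕ → List (Fin (suc m))
  orbit x zero = x ∷ []
  orbit x (suc k) = x ∷ orbit (rotate 1 x) k

  orbit-walk : ∀ k {x v} → rotate k x ≡ v → Walk (Cycle (suc m)) x v (orbit x k)
  orbit-walk zero {x} eq with refl ← trans (sym (rotate-zero x)) eq = here x
  orbit-walk (suc k) {x} eq = step (rotate-1-arc x) (orbit-walk k (trans (rotate-+ k 1 x) eq))

  walk⇒orbit : ∀ {u v xs} → Walk (Cycle (suc m)) u v xs → ∃[ k ] xs ≡ orbit u k × rotate k u ≡ v
  walk⇒orbit (here x) = 0 , refl , rotate-zero x
  walk⇒orbit {u} (step arc walk) with refl ← arc⇒rotate-1 arc | k , refl , eq ← walk⇒orbit walk =
    suc k , refl , trans (sym (rotate-+ k 1 u)) eq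

  ∈-orbit⁺ : ∀ {i k} x → i ≤ k → rotate i x ∈ orbit x k
  ∈-orbit⁺ {zero} {zero} x _ = here (rotate-zero x)
  ∈-orbit⁺ {zero} {suc k} x _ = here (rotate-zero x)
  ∈-orbit⁺ {suc i} {suc k} x (s≤s i≤k) =
    there (subst (_∈ orbit (rotate 1 x) k) (rotate-+ i 1 x) (∈-orbit⁺ (rotate 1 x) i≤k))

  ∈-orbit⁻ : ∀ {y} k x → y ∈ orbit x k → ∃[ i ] i ≤ k × rotate i x ≡ y
  ∈-orbit⁻ zero x (here refl) = 0 , z≤n , rotate-zero x
  ∈-orbit⁻ (suc k) x (here refl) = 0 , z≤n , rotate-zero x
  ∈-orbit⁻ (suc k) x (there y∈) with i , i≤k , eq ← ∈-orbit⁻ k (rotate 1 x) y∈ =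
    suc i , s≤s i≤k , trans (sym (rotate-+ i 1 x)) eq

  orbit-unique : ∀ k x → k < suc m → Unique (orbit x k)
  orbit-unique zero x _ = [] ∷ []
  orbit-unique (suc k) x k<n = All.tabulate x≢ ∷ orbit-unique k (rotate 1 x) (<-trans (n<1+n k) k<n)
    where
    x≢ : ∀ {y} → y ∈ orbit (rotate 1 x) k → x ≢ y
    x≢ y∈ x≡y with i , i≤k , eq ← ∈-orbit⁻ k (rotate 1 x) y∈ =
      0≢1+n (rotate-injective (≤-trans (s≤s z≤n) k<n) (≤-<-trans (s≤s i≤k) k<n)
        (trans (rotate-zero x) (trans x≡y (trans (sym eq) (rotate-+ i 1 x)))))

  unique-orbit⇒< : ∀ k x → Unique (orbit x k) → k < suc m
  unique-orbit⇒< zero x _ = s≤s z≤n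
  unique-orbit⇒< (suc k) x (x≢ ∷ _) with m ≤? k
  ... | no m≰k = s≤s (≰⇒> m≰k)
  ... | yes m≤k = ⊥-elim (All.lookup x≢ (∈-orbit⁺ (rotate 1 x) m≤k)
                           (sym (trans (rotate-+ m 1 x) (rotate-suc-m x))))

  path≡orbit : ∀ {u v xs k} → IsPath (Cycle (suc m)) u v xs → k < suc m → rotate k u ≡ v → xs ≡ orbit u k
  path≡orbit (walk , unique) k<n eq with k′ , refl , eq′ ← walk⇒orbit walk =
    cong (orbit _) (rotate-injective (unique-orbit⇒< k′ _ unique) k<n (trans eq′ (sym eq)))

  orbit-geodesic : ∀ k x → k < suc m → IsGeodesic (Cycle (suc m)) x (rotate k x) (orbit x k)
  orbit-geodesic k x k<n =
    (orbit-walk k refl , orbit-unique k x k<n) ,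
    λ ys path → ≤-reflexive (cong length (sym (path≡orbit path k<n refl)))

  internal-orbit : ∀ k x → internal (orbit x (2 + k)) ≡ orbit (rotate 1 x) k
  internal-orbit k x = dropLast-orbit k (rotate 1 x)
    where
    dropLast-orbit : ∀ k x → dropLast (orbit x (suc k)) ≡ orbit x k
    dropLast-orbit zero x = refl
    dropLast-orbit (suc k) x = cong (x ∷_) (dropLast-orbit k (rotate 1 x))

  -- orbit x k is the run x, x + 1, …, x + k (mod n), of k + 1 ≤ n − 2 vertices here.
  ShortOrbitsRainbow : ∀ {j} → (Fin (suc m) → Fin j) → Set
  ShortOrbitsRainbow c = ∀ x k → 2 + k < suc m → Unique (map c (orbit x k))

  module _ {j} {c : Fin (suc m) → Fin j} where

    ShortOrbitsRainbow⇒SRVConnected : ShortOrbitsRainbow c → SRVConnected (Cycle (suc m)) c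
    ShortOrbitsRainbow⇒SRVConnected rainbow u v with k , k<n , refl ← rotate-surjective u v =
      orbit u k , orbit-geodesic k u k<n , orbit-rainbow k k<n
      where
      orbit-rainbow : ∀ k → k < suc m → Rainbow c (orbit u k)
      orbit-rainbow 0 _ = []
      orbit-rainbow 1 _ = []
      orbit-rainbow (suc (suc k)) 2+k<n rewrite internal-orbit k u = rainbow (rotate 1 u) k 2+k<n

    RVConnected⇒ShortOrbitsRainbow : RVConnected (Cycle (suc m)) c → ShortOrbitsRainbow c
    RVConnected⇒ShortOrbitsRainbow rvc x k 2+k<n
      with xs , path , rainbow ← rvc (rotate m x) (rotate (2 + k) (rotate m x))
      with refl ← path≡orbit path 2+k<n refl
      rewrite internal-orbit k (rotate m x) = subst (λ y → Unique (map c (orbit y k))) next-pred rainbow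
      where
      next-pred : rotate 1 (rotate m x) ≡ x
      next-pred = trans (rotate-+ 1 m x) (trans (cong (λ t → rotate t x) (+-comm m 1)) (rotate-suc-m x))

    orbit-endpoints-coloured-apart : ∀ {k x} → Unique (map c (orbit x k)) → 0 < k → c x ≢ c (rotate k x)
    orbit-endpoints-coloured-apart {suc k} {x} (c≢ ∷ _) _ cx≡ =
      All.lookup (map⁻ c≢) (∈-orbit⁺ (rotate 1 x) ≤-refl) (trans cx≡ (cong c (sym (rotate-+ k 1 x))))

    -- Two vertices are at distance at most n − 3 along the cycle in one of the two
    -- directions as soon as n ≥ 5, so a short orbit contains both.
    ShortOrbitsRainbow⇒injective : 4 ≤ m → ShortOrbitsRainbow c → Injective _≡_ _≡_ c
    ShortOrbitsRainbow⇒injective 4≤m rainbow {a} {b} ca≡cb with rotate-surjective a b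
    ... | zero , _ , refl = sym (rotate-zero a)
    ... | suc k , k<n , refl with 2 + suc k <? suc m
    ...   | yes short = ⊥-elim (orbit-endpoints-coloured-apart (rainbow a (suc k) short) (s≤s z≤n) ca≡cb)
    ...   | no ¬short = ⊥-elim (orbit-endpoints-coloured-apart (rainbow b k′ short′) (m<n⇒0<n∸m k<n)
                          (trans (sym ca≡cb) (cong c (sym back))))
      where
      k′ = suc m ∸ suc k
      back : rotate k′ b ≡ a
      back = trans (rotate-+ k′ (suc k) a)
               (trans (cong (λ t → rotate t a) (m+[n∸m]≡n (<⇒≤ k<n))) (rotate-suc-m a))
      k′≤2 : k′ ≤ 2
      k′≤2 = m≤n+o⇒m∸n≤o (suc m) (suc k) (subst (suc m ≤_) (+-comm 2 (suc k)) (≮⇒≥ ¬short))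
      short′ : 2 + k′ < suc m
      short′ = s≤s (≤-trans (+-monoʳ-≤ 2 k′≤2) 4≤m)

  cycle-rvc≡×srvc≡ : ∀ {k} → Σ (Fin (suc m) → Fin k) ShortOrbitsRainbow →
                     (∀ j → j < k → ¬ Σ (Fin (suc m) → Fin j) ShortOrbitsRainbow) →
                     rvc≡ (Cycle (suc m)) k × srvc≡ (Cycle (suc m)) k
  cycle-rvc≡×srvc≡ (c , rainbow) noRainbow =
    rvc≡×srvc≡ (Cycle (suc m)) (c , ShortOrbitsRainbow⇒SRVConnected rainbow)
      λ j j<k (c′ , rvc) → noRainbow j j<k (c′ , RVConnected⇒ShortOrbitsRainbow rvc)

rvc≡×srvc≡-C₃ : rvc≡ (Cycle 3) 1 × srvc≡ (Cycle 3) 1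
rvc≡×srvc≡-C₃ = cycle-rvc≡×srvc≡ ((λ _ → zero) , singletons) noRainbow
  where
  singletons : ShortOrbitsRainbow {m = 2} (λ _ → zero)
  singletons x zero _ = [] ∷ []
  singletons x (suc k) (s≤s (s≤s (s≤s ())))
  noRainbow : ∀ j → j < 1 → ¬ Σ (Fin 3 → Fin j) ShortOrbitsRainbow
  noRainbow zero _ (c , _) with c zero
  ... | ()
  noRainbow (suc j) (s≤s ())

rvc≡×srvc≡-C₄ : rvc≡ (Cycle 4) 2 × srvc≡ (Cycle 4) 2
rvc≡×srvc≡-C₄ = cycle-rvc≡×srvc≡ (parity , alternating) noRainbow
  where
  parity : Fin 4 → Fin 2
  parity x = toℕ x mod 2
  parity≢next : ∀ x → parity x ≢ parity (rotate 1 x)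
  parity≢next zero ()
  parity≢next (suc zero) ()
  parity≢next (suc (suc zero)) ()
  parity≢next (suc (suc (suc zero))) ()
  alternating : ShortOrbitsRainbow parity
  alternating x zero _ = [] ∷ []
  alternating x (suc zero) _ = (parity≢next x ∷ []) ∷ [] ∷ []
  alternating x (suc (suc k)) (s≤s (s≤s (s≤s (s≤s ()))))
  noRainbow : ∀ j → j < 2 → ¬ Σ (Fin 4 → Fin j) ShortOrbitsRainbow
  noRainbow zero _ (c , _) with c zero
  ... | ()
  noRainbow (suc zero) _ (c , rainbow) with c zero | c (rotate 1 zero) | rainbow zero 1 ≤-refl
  ... | zero | zero | (c≢ ∷ []) ∷ _ = c≢ refl
  noRainbow (suc (suc j)) (s≤s (s≤s ()))

rvc≡×srvc≡-C₅₊ : ∀ q → rvc≡ (Cycle (5 + q)) (5 + q) × srvc≡ (Cycle (5 + q)) (5 + q)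
rvc≡×srvc≡-C₅₊ q = cycle-rvc≡×srvc≡ (id , distinct) λ j j<n (c , rainbow) →
  <⇒notInjective j<n (ShortOrbitsRainbow⇒injective (s≤s (s≤s (s≤s (s≤s z≤n)))) rainbow)
  where
  distinct : ShortOrbitsRainbow id
  distinct x k 2+k<n = subst Unique (sym (map-id _)) (orbit-unique k x (m+n≤o⇒n≤o 2 2+k<n))

proposition8 : ∀ (n : ℕ) → 3 ≤ n →
    ((n ≤ 4 → rvc≡ (Cycle n) (n ∸ 2) × srvc≡ (Cycle n) (n ∸ 2))
    × (5 ≤ n → rvc≡ (Cycle n) n × srvc≡ (Cycle n) n))
proposition8 0 ()
proposition8 1 (s≤s ())
proposition8 2 (s≤s (s≤s ()))
proposition8 3 _ = (λ _ → rvc≡×srvc≡-C₃) , λ { (s≤s (s≤s (s≤s ()))) }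
proposition8 4 _ = (λ _ → rvc≡×srvc≡-C₄) , λ { (s≤s (s≤s (s≤s (s≤s ())))) }
proposition8 (suc (suc (suc (suc (suc q))))) _ = (λ { (s≤s (s≤s (s≤s (s≤s ())))) }) , λ _ → rvc≡×srvc≡-C₅₊ q
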